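{- Let $C\ge 1$ and write $C=\frac{k(k+1)}{2}+r$ with integers $k\ge 1$, $0\le r\le k$. Then $$\rho(C)=\max_{p\ge 2}\frac{\gamma(C,p)}{p}=k+\frac{r}{k+1}.$$
   Context: For $p\ge 2$ let $\vec C_p$ be the directed cycle on $\{0,\dots,p-1\}$ with arcs $(i,i+1\bmod p)$. Let $H$ be an oriented graph on $\{0,\dots,p-1\}$ (no loops and at most one arc between any two vertices). Each arc $(i,j)$ of $H$ is routed along the directed path from $i$ to $j$ in $\vec C_p$; for an arc $e$ of $\vec C_p$, the load $L(H,e)$ is the number of arcs of $H$ whose route contains $e$. $\gamma(C,p)$ denotes the maximum number of arcs of such an $H$ satisfying $L(H,e)\le C$ for every arc $e$ of $\vec C_p$, and $\rho(C)=\max_{p\ge 2}\gamma(C,p)/p$. -}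

module Defs where

open import Data.Nat using (ℕ; zero; suc; _+_; _*_; _∸_; _≤ᵇ_; _<ᵇ_)
open import Data.Bool using (Bool; true; false; if_then_else_; _∧_)
open import Data.Fin using (Fin; toℕ)
open import Data.List using (map; allFin)
open import Data.Nat.ListAction using (sum)
open import Data.Product using (_×_)
open import Relation.Nullary using (¬_)
open import Relation.Binary.PropositionalEquality using (_≡_)

Σ[_] : (p : ℕ) → (Fin p → ℕ) → ℕ
Σ[ p ] f = sum (map f (allFin p))

ind : Bool → ℕ
ind b = if b then 1 else 0

-- number of arcs of dirC_p on the directed path from i to j,
-- i.e. (j - i) mod p
dist : (p : ℕ) → Fin p → Fin p → ℕ
dist p i j = if toℕ i ≤ᵇ toℕ j then toℕ j ∸ toℕ i else (p + toℕ j) ∸ toℕ i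

-- the arc (e, e+1 mod p) of dirC_p lies on the route of (i, j)
onRoute : (p : ℕ) → Fin p → Fin p → Fin p → Bool
onRoute p e i j = dist p i e <ᵇ dist p i j

Digraph : ℕ → Set
Digraph p = Fin p → Fin p → Bool

Oriented : (p : ℕ) → Digraph p → Set
Oriented p A = (∀ i → A i i ≡ false) × (∀ i j → ¬ (A i j ≡ true × A j i ≡ true))

arcs : (p : ℕ) → Digraph p → ℕ
arcs p A = Σ[ p ] (λ i → Σ[ p ] (λ j → ind (A i j)))

load : (p : ℕ) → Digraph p → Fin p → ℕ
load p A e = Σ[ p ] (λ i → Σ[ p ] (λ j → ind (A i j ∧ onRoute p e i j)))

Admissible : ℕ → (p : ℕ) → Digraph p → Set
Admissible C p A = Oriented p A × (∀ e → load p A e Data.Nat.≤ C)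

-- Upper bound: an arc of length d ≥ 1 satisfies k + 1 ≤ d + excess k d, where
-- excess k d = (k + 1 − d)⁺.  Summed over all arcs, the lengths add up to the total load, at most
-- pC, and since the arcs leaving a vertex have distinct lengths their excesses add up to at most
-- k + (k − 1) + ⋯ + 1 = k(k + 1)/2.  Hence (k + 1)·|H| ≤ p·(C + k(k + 1)/2) = p·(k(k + 1) + r).
-- Equality: on p = 3(k + 1) vertices let every vertex a send arcs of lengths 1, …, k, and one of
-- length k + 1 when a mod (k + 1) < r.  The vertex at distance d ≤ k behind an arc loads it with
-- k − d short arcs, and of the k + 1 vertices that can load it with a long arc exactly r have
-- residue below r, so every load is k(k + 1)/2 + r = C.

module Submission where

open import Data.Bool using (Bool; true; false; T; _∧_; _∨_; if_then_else_)
open import Data.Bool.Properties using (∧-identityʳ)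
open import Data.Fin as Fin using (Fin; toℕ)
open import Data.Fin.Properties using (toℕ<n; toℕ-injective)
open import Data.List using (tabulate)
open import Data.List.Properties using (map-tabulate)
import Data.Nat.ListAction as List
open import Data.Nat
open import Data.Nat.DivMod
open import Data.Nat.Divisibility using (n∣m*n)
open import Data.Nat.Properties
open import Algebra.Properties.Semiring.Sum +-*-semiring
  using (sum-syntax; sum-cong-≗; ∑-distrib-+; ∑-comm; *-distribˡ-sum; *-distribʳ-sum)
open import Data.Nat.Tactic.RingSolver using (solve-∀)
open import Data.Product using (_×_; _,_; ∃-syntax; Σ-syntax)
open import Function using (id; _∘_)
open import Relation.Binary.PropositionalEquality
open import Relation.Binary.Definitions using (tri<; tri≈; tri>)
open import Relation.Nullary using (¬_; contradiction; yes; no; ofʸ; ofⁿ)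

open import Defs

m+n∸o<m : ∀ {m n o} → o ≤ m → n < o → m + n ∸ o < m
m+n∸o<m {m} {n} {o} o≤m n<o = begin-strict
  m + n ∸ o  ≡⟨ +-∸-comm n o≤m ⟩
  m ∸ o + n  <⟨ +-monoʳ-< (m ∸ o) n<o ⟩
  m ∸ o + o  ≡⟨ m∸n+n≡m o≤m ⟩
  m          ∎
  where open ≤-Reasoning

m∸[n∸o]≡m∸n+o : ∀ {m n o} → o ≤ n → n ≤ m → m ∸ (n ∸ o) ≡ m ∸ n + o
m∸[n∸o]≡m∸n+o {m} {n} {o} o≤n n≤m = begin
  m ∸ (n ∸ o)             ≡⟨ cong (_∸ (n ∸ o)) (m∸n+n≡m n≤m) ⟨
  m ∸ n + n ∸ (n ∸ o)     ≡⟨ +-∸-assoc (m ∸ n) (m∸n≤m n o) ⟩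
  m ∸ n + (n ∸ (n ∸ o))   ≡⟨ cong (m ∸ n +_) (m∸[m∸n]≡n o≤n) ⟩
  m ∸ n + o               ∎
  where open ≡-Reasoning

[n+m]%n≡m%n : ∀ m n .{{_ : NonZero n}} → (n + m) % n ≡ m % n
[n+m]%n≡m%n m n = trans (cong (_% n) (+-comm n m)) ([m+n]%n≡m%n m n)

ind-∧ : ∀ x y → ind (x ∧ y) ≡ ind x * ind y
ind-∧ false y = refl
ind-∧ true  y = sym (+-identityʳ (ind y))

<ᵇ∧≡ᵇ : ∀ m n → (m <ᵇ n) ∧ (m ≡ᵇ n) ≡ false
<ᵇ∧≡ᵇ zero    zero    = refl
<ᵇ∧≡ᵇ zero    (suc n) = refl
<ᵇ∧≡ᵇ (suc m) zero    = refl
<ᵇ∧≡ᵇ (suc m) (suc n) = <ᵇ∧≡ᵇ m n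

ind-∨∧ : ∀ x y w z → x ∧ y ≡ false →
         ind ((x ∨ (y ∧ w)) ∧ z) ≡ ind x * ind z + ind y * ind (z ∧ w)
ind-∨∧ true  false w     true  _ = refl
ind-∨∧ true  false w     false _ = refl
ind-∨∧ false true  true  true  _ = refl
ind-∨∧ false true  true  false _ = refl
ind-∨∧ false true  false true  _ = refl
ind-∨∧ false true  false false _ = refl
ind-∨∧ false false w     z     _ = refl

-- Finite sums

Σ≡∑ : ∀ n (f : Fin n → ℕ) → Σ[ n ] f ≡ ∑[ i < n ] f i
Σ≡∑ n f = trans (cong List.sum (map-tabulate id f)) (sum-tabulate f)
  where
  sum-tabulate : ∀ {n} (f : Fin n → ℕ) → List.sum (tabulate f) ≡ ∑[ i < n ] f i
  sum-tabulate {zero}  f = refl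
  sum-tabulate {suc n} f = cong (f Fin.zero +_) (sum-tabulate (f ∘ Fin.suc))

ΣΣ≡∑∑ : ∀ n (f : Fin n → Fin n → ℕ) →
        Σ[ n ] (λ i → Σ[ n ] (f i)) ≡ ∑[ i < n ] ∑[ j < n ] f i j
ΣΣ≡∑∑ n f = trans (Σ≡∑ n _) (sum-cong-≗ (λ i → Σ≡∑ n (f i)))

∑-mono-≤ : ∀ {n} {f g : Fin n → ℕ} → (∀ i → f i ≤ g i) → ∑[ i < n ] f i ≤ ∑[ i < n ] g i
∑-mono-≤ {zero}  f≤g = z≤n
∑-mono-≤ {suc n} f≤g = +-mono-≤ (f≤g Fin.zero) (∑-mono-≤ (f≤g ∘ Fin.suc))

∑-const : ∀ n c → ∑[ i < n ] c ≡ n * c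
∑-const zero    c = refl
∑-const (suc n) c = cong (c +_) (∑-const n c)

∑-zero : ∀ n → ∑[ i < n ] 0 ≡ 0
∑-zero n = trans (∑-const n 0) (*-zeroʳ n)

∑< : ℕ → (ℕ → ℕ) → ℕ
∑< n g = ∑[ i < n ] g (toℕ i)

∑<-cong : ∀ n {f g : ℕ → ℕ} → (∀ m → m < n → f m ≡ g m) → ∑< n f ≡ ∑< n g
∑<-cong zero    f≡g = refl
∑<-cong (suc n) f≡g = cong₂ _+_ (f≡g 0 z<s) (∑<-cong n (λ m m<n → f≡g (suc m) (s<s m<n)))

∑<-++ : ∀ a b (g : ℕ → ℕ) → ∑< (a + b) g ≡ ∑< a g + ∑< b (λ m → g (a + m))
∑<-++ zero    b g = refl
∑<-++ (suc a) b g = trans (cong (g 0 +_) (∑<-++ a b (g ∘ suc))) (sym (+-assoc (g 0) _ _))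

∑<-snoc : ∀ n (g : ℕ → ℕ) → ∑< (suc n) g ≡ ∑< n g + g n
∑<-snoc zero    g = +-comm (g 0) 0
∑<-snoc (suc n) g = trans (cong (g 0 +_) (∑<-snoc n (g ∘ suc))) (sym (+-assoc (g 0) _ _))

∑<-reverse : ∀ n (g : ℕ → ℕ) → ∑< n (λ m → g (n ∸ suc m)) ≡ ∑< n g
∑<-reverse zero    g = refl
∑<-reverse (suc n) g = begin
  g n + ∑< n (λ m → g (n ∸ suc m)) ≡⟨ cong (g n +_) (∑<-reverse n g) ⟩
  g n + ∑< n g                     ≡⟨ +-comm (g n) _ ⟩
  ∑< n g + g n                     ≡⟨ ∑<-snoc n g ⟨
  ∑< (suc n) g                     ∎
  where open ≡-Reasoning

∑<-rotate : ∀ n c (g : ℕ → ℕ) .{{_ : NonZero n}} → ∑< n (λ m → g ((c + m) % n)) ≡ ∑< n g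
∑<-rotate n zero    g = ∑<-cong n (λ m m<n → cong g (m<n⇒m%n≡m m<n))
∑<-rotate n (suc c) g = begin
  ∑< n (λ m → g ((suc c + m) % n)) ≡⟨ ∑<-cong n (λ m _ → cong (λ x → g (x % n)) (+-suc c m)) ⟨
  ∑< n (f ∘ suc)                   ≡⟨ +-cancelˡ-≡ (f 0) _ _ shift ⟩
  ∑< n f                           ≡⟨ ∑<-rotate n c g ⟩
  ∑< n g                           ∎
  where
  open ≡-Reasoning
  f : ℕ → ℕ
  f m = g ((c + m) % n)
  -- f has period n, so shifting the window by one trades f 0 for f n = f 0.
  shift : f 0 + ∑< n (f ∘ suc) ≡ f 0 + ∑< n f
  shift = begin
    ∑< (suc n) f       ≡⟨ ∑<-snoc n f ⟩
    ∑< n f + f n       ≡⟨ cong (λ x → ∑< n f + g x) ([m+n]%n≡m%n c n) ⟩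
    ∑< n f + g (c % n) ≡⟨ cong (λ x → ∑< n f + g (x % n)) (+-identityʳ c) ⟨
    ∑< n f + f 0       ≡⟨ +-comm _ (f 0) ⟩
    f 0 + ∑< n f       ∎

∑<-periodic : ∀ q n (g : ℕ → ℕ) .{{_ : NonZero n}} → ∑< (q * n) (λ m → g (m % n)) ≡ q * ∑< n g
∑<-periodic zero    n g = refl
∑<-periodic (suc q) n g = begin
  ∑< (n + q * n) (λ m → g (m % n))
    ≡⟨ ∑<-++ n (q * n) (λ m → g (m % n)) ⟩
  ∑< n (λ m → g (m % n)) + ∑< (q * n) (λ m → g ((n + m) % n))
    ≡⟨ cong₂ _+_ (∑<-rotate n 0 g) (∑<-cong (q * n) (λ m _ → cong g ([n+m]%n≡m%n m n))) ⟩
  ∑< n g + ∑< (q * n) (λ m → g (m % n))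
    ≡⟨ cong (∑< n g +_) (∑<-periodic q n g) ⟩
  ∑< n g + q * ∑< n g ∎
  where open ≡-Reasoning

∑<-restrict : ∀ {n b} (g : ℕ → ℕ) → b ≤ n → ∑< n (λ m → ind (m <ᵇ b) * g m) ≡ ∑< b g
∑<-restrict {n}     {zero}  g _         = ∑-zero n
∑<-restrict {suc n} {suc b} g (s≤s b≤n) =
  cong₂ _+_ (+-identityʳ (g 0)) (∑<-restrict (g ∘ suc) b≤n)

∑<-below : ∀ {n b} → b ≤ n → ∑< n (λ m → ind (m <ᵇ b)) ≡ b
∑<-below {n} {b} b≤n = begin
  ∑< n (λ m → ind (m <ᵇ b))     ≡⟨ ∑<-cong n (λ m _ → *-identityʳ (ind (m <ᵇ b))) ⟨
  ∑< n (λ m → ind (m <ᵇ b) * 1) ≡⟨ ∑<-restrict (λ _ → 1) b≤n ⟩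
  ∑< b (λ _ → 1)                ≡⟨ trans (∑-const b 1) (*-identityʳ b) ⟩
  b                             ∎
  where open ≡-Reasoning

∑<-above : ∀ n a → ∑< n (λ m → ind (a <ᵇ m)) ≡ n ∸ suc a
∑<-above zero    a       = refl
∑<-above (suc n) zero    = trans (∑-const n 1) (*-identityʳ n)
∑<-above (suc n) (suc a) = ∑<-above n a

∑<-sift : ∀ {n c} (g : ℕ → ℕ) → c < n → ∑< n (λ m → ind (m ≡ᵇ c) * g m) ≡ g c
∑<-sift {suc n} {zero}  g _         = begin
  (g 0 + 0) + ∑[ i < n ] 0 ≡⟨ cong₂ _+_ (+-identityʳ (g 0)) (∑-zero n) ⟩
  g 0 + 0                  ≡⟨ +-identityʳ (g 0) ⟩
  g 0                      ∎
  where open ≡-Reasoning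
∑<-sift {suc n} {suc c} g (s≤s c<n) = ∑<-sift (g ∘ suc) c<n

triangular : ℕ → ℕ
triangular zero    = 0
triangular (suc k) = suc k + triangular k

triangular*2 : ∀ k → triangular k * 2 ≡ k * suc k
triangular*2 zero    = refl
triangular*2 (suc k) = begin
  (suc k + triangular k) * 2       ≡⟨ *-distribʳ-+ 2 (suc k) (triangular k) ⟩
  suc k * 2 + triangular k * 2     ≡⟨ cong (suc k * 2 +_) (triangular*2 k) ⟩
  suc k * 2 + k * suc k            ≡⟨ lemma k ⟩
  suc k * suc (suc k)              ∎
  where
  open ≡-Reasoning
  lemma : ∀ k → suc k * 2 + k * suc k ≡ suc k * suc (suc k)
  lemma = solve-∀

k*[1+k]/2≡triangular : ∀ k → k * suc k / 2 ≡ triangular k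
k*[1+k]/2≡triangular k = trans (cong (_/ 2) (sym (triangular*2 k))) (m*n/n≡m (triangular k) 2)

∑<-∸-≤-triangular : ∀ n k → ∑< n (k ∸_) ≤ triangular k
∑<-∸-≤-triangular zero    k       = z≤n
∑<-∸-≤-triangular (suc n) zero    = ≤-reflexive (∑-zero n)
∑<-∸-≤-triangular (suc n) (suc k) = +-monoʳ-≤ (suc k) (∑<-∸-≤-triangular n k)

-- Distances on the directed cycle

distℕ : ℕ → ℕ → ℕ → ℕ
distℕ p a b = if a ≤ᵇ b then b ∸ a else p + b ∸ a

distℕ-≤ : ∀ p {a b} → a ≤ b → distℕ p a b ≡ b ∸ a
distℕ-≤ p {a} {b} a≤b with a ≤ᵇ b | ≤ᵇ-reflects-≤ a b
... | true  | _       = refl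
... | false | ofⁿ a≰b = contradiction a≤b a≰b

distℕ-> : ∀ p {a b} → b < a → distℕ p a b ≡ p + b ∸ a
distℕ-> p {a} {b} b<a with a ≤ᵇ b | ≤ᵇ-reflects-≤ a b
... | true  | ofʸ a≤b = contradiction a≤b (<⇒≱ b<a)
... | false | _       = refl

distℕ-self : ∀ p a → distℕ p a a ≡ 0
distℕ-self p a = trans (distℕ-≤ p {a} ≤-refl) (n∸n≡0 a)

distℕ≡% : ∀ {p a b} .{{_ : NonZero p}} → a < p → b < p → distℕ p a b ≡ (p + b ∸ a) % p
distℕ≡% {p} {a} {b} a<p b<p with a ≤? b
... | yes a≤b = begin
  distℕ p a b       ≡⟨ distℕ-≤ p a≤b ⟩
  b ∸ a             ≡⟨ m<n⇒m%n≡m (≤-<-trans (m∸n≤m b a) b<p) ⟨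
  (b ∸ a) % p       ≡⟨ [n+m]%n≡m%n (b ∸ a) p ⟨
  (p + (b ∸ a)) % p ≡⟨ cong (_% p) (+-∸-assoc p a≤b) ⟨
  (p + b ∸ a) % p   ∎
  where open ≡-Reasoning
... | no a≰b = trans (distℕ-> p (≰⇒> a≰b)) (sym (m<n⇒m%n≡m (m+n∸o<m (<⇒≤ a<p) (≰⇒> a≰b))))

distℕ≡0⇒≡ : ∀ {p a b} → a < p → distℕ p a b ≡ 0 → a ≡ b
distℕ≡0⇒≡ {p} {a} {b} a<p d≡0 with a ≤? b
... | yes a≤b = ≤-antisym a≤b (m∸n≡0⇒m≤n (trans (sym (distℕ-≤ p a≤b)) d≡0))
... | no a≰b  = contradiction (m∸n≡0⇒m≤n p+b∸a≡0) (<⇒≱ (<-≤-trans a<p (m≤m+n p b)))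
  where
  p+b∸a≡0 : p + b ∸ a ≡ 0
  p+b∸a≡0 = trans (sym (distℕ-> p (≰⇒> a≰b))) d≡0

distℕ+distℕ-< : ∀ {p a b} → a < b → b < p → distℕ p a b + distℕ p b a ≡ p
distℕ+distℕ-< {p} {a} {b} a<b b<p = begin
  distℕ p a b + distℕ p b a ≡⟨ cong₂ _+_ (distℕ-≤ p (<⇒≤ a<b)) (distℕ-> p a<b) ⟩
  b ∸ a + (p + a ∸ b)       ≡⟨ cong (b ∸ a +_) (+-∸-comm a (<⇒≤ b<p)) ⟩
  b ∸ a + (p ∸ b + a)       ≡⟨ x+[y+z]≡y+[x+z] (b ∸ a) (p ∸ b) a ⟩
  p ∸ b + (b ∸ a + a)       ≡⟨ cong (p ∸ b +_) (m∸n+n≡m (<⇒≤ a<b)) ⟩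
  p ∸ b + b                 ≡⟨ m∸n+n≡m (<⇒≤ b<p) ⟩
  p                         ∎
  where
  open ≡-Reasoning
  x+[y+z]≡y+[x+z] : ∀ x y z → x + (y + z) ≡ y + (x + z)
  x+[y+z]≡y+[x+z] = solve-∀

distℕ+distℕ : ∀ {p a b} → a < p → b < p → a ≢ b → distℕ p a b + distℕ p b a ≡ p
distℕ+distℕ {p} {a} {b} a<p b<p a≢b with <-cmp a b
... | tri< a<b _ _   = distℕ+distℕ-< a<b b<p
... | tri≈ _ a≡b _   = contradiction a≡b a≢b
... | tri> _ _ b<a   = trans (+-comm (distℕ p a b) _) (distℕ+distℕ-< b<a a<p)

distℕ-involutive : ∀ {p a e} → a < p → distℕ p (distℕ p a e) e ≡ a
distℕ-involutive {p} {a} {e} a<p with a ≤? e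
... | yes a≤e = begin
  distℕ p (distℕ p a e) e ≡⟨ cong (λ d → distℕ p d e) (distℕ-≤ p a≤e) ⟩
  distℕ p (e ∸ a) e       ≡⟨ distℕ-≤ p (m∸n≤m e a) ⟩
  e ∸ (e ∸ a)             ≡⟨ m∸[m∸n]≡n a≤e ⟩
  a                       ∎
  where open ≡-Reasoning
... | no a≰e = begin
  distℕ p (distℕ p a e) e ≡⟨ cong (λ d → distℕ p d e) (distℕ-> p (≰⇒> a≰e)) ⟩
  distℕ p (p + e ∸ a) e   ≡⟨ distℕ-> p e<p+e∸a ⟩
  p + e ∸ (p + e ∸ a)     ≡⟨ m∸[m∸n]≡n (≤-trans (<⇒≤ a<p) (m≤m+n p e)) ⟩
  a                       ∎
  where
  open ≡-Reasoning
  e<p+e∸a : e < p + e ∸ a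
  e<p+e∸a = <-≤-trans (m<n+m e (m<n⇒0<n∸m a<p)) (≤-reflexive (sym (+-∸-comm e (<⇒≤ a<p))))

∑<-distℕ-from : ∀ {p a} (h : ℕ → ℕ) .{{_ : NonZero p}} → a < p →
                ∑< p (λ m → h (distℕ p a m)) ≡ ∑< p h
∑<-distℕ-from {p} {a} h a<p = begin
  ∑< p (λ m → h (distℕ p a m))     ≡⟨ ∑<-cong p (λ m m<p → cong h (from-mod m<p)) ⟩
  ∑< p (λ m → h ((p ∸ a + m) % p)) ≡⟨ ∑<-rotate p (p ∸ a) h ⟩
  ∑< p h                           ∎
  where
  open ≡-Reasoning
  from-mod : ∀ {m} → m < p → distℕ p a m ≡ (p ∸ a + m) % p
  from-mod {m} m<p = trans (distℕ≡% a<p m<p) (cong (_% p) (+-∸-comm m (<⇒≤ a<p)))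

∑<-distℕ-to : ∀ {p c} (h : ℕ → ℕ) .{{_ : NonZero p}} → c < p →
              ∑< p (λ m → h (distℕ p m c)) ≡ ∑< p h
∑<-distℕ-to {p} {c} h c<p = begin
  ∑< p (λ m → h (distℕ p m c))           ≡⟨ ∑<-reverse p (λ m → h (distℕ p m c)) ⟨
  ∑< p (λ m → h (distℕ p (p ∸ suc m) c)) ≡⟨ ∑<-cong p (λ m m<p → cong h (to-mod m<p)) ⟩
  ∑< p (λ m → h ((suc c + m) % p))       ≡⟨ ∑<-rotate p (suc c) h ⟩
  ∑< p h                                 ∎
  where
  open ≡-Reasoning
  to-mod : ∀ {m} → m < p → distℕ p (p ∸ suc m) c ≡ (suc c + m) % p
  to-mod {m} m<p = begin
    distℕ p (p ∸ suc m) c     ≡⟨ distℕ≡% (∸-monoʳ-< z<s m<p) c<p ⟩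
    (p + c ∸ (p ∸ suc m)) % p ≡⟨ cong (_% p) (+-∸-comm c (m∸n≤m p (suc m))) ⟩
    (p ∸ (p ∸ suc m) + c) % p ≡⟨ cong (λ x → (x + c) % p) (m∸[m∸n]≡n m<p) ⟩
    (suc m + c) % p           ≡⟨ cong (λ x → suc x % p) (+-comm m c) ⟩
    (suc c + m) % p           ∎

dist< : ∀ {p} (i j : Fin p) → dist p i j < p
dist< {suc p} i j =
  subst (_< suc p) (sym (distℕ≡% (toℕ<n i) (toℕ<n j))) (m%n<n (suc p + toℕ j ∸ toℕ i) (suc p))

dist≡0⇒≡ : ∀ {p} (i j : Fin p) → dist p i j ≡ 0 → i ≡ j
dist≡0⇒≡ i j d≡0 = toℕ-injective (distℕ≡0⇒≡ (toℕ<n i) d≡0)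

∑-dist-from : ∀ {p} (i : Fin p) (h : ℕ → ℕ) → ∑[ j < p ] h (dist p i j) ≡ ∑< p h
∑-dist-from {suc p} i h = ∑<-distℕ-from h (toℕ<n i)

∑-dist-to : ∀ {p} (e : Fin p) (F : ℕ → ℕ → ℕ) →
            ∑[ i < p ] F (toℕ i) (dist p i e) ≡ ∑< p (λ d → F (distℕ p d (toℕ e)) d)
∑-dist-to {suc p} e F = begin
  ∑< (suc p) (λ a → F a (distℕ (suc p) a c))
    ≡⟨ ∑<-cong (suc p) (λ a a<p → cong (λ x → F x (distℕ (suc p) a c))
                                      (distℕ-involutive {e = c} a<p)) ⟨
  ∑< (suc p) (λ a → G (distℕ (suc p) a c))
    ≡⟨ ∑<-distℕ-to G (toℕ<n e) ⟩
  ∑< (suc p) G ∎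
  where
  open ≡-Reasoning
  c : ℕ
  c = toℕ e
  G : ℕ → ℕ
  G d = F (distℕ (suc p) d c) d

-- The upper bound

∑-onRoute : ∀ {p} (i j : Fin p) → ∑[ e < p ] ind (onRoute p e i j) ≡ dist p i j
∑-onRoute {p} i j = trans (∑-dist-from i (λ m → ind (m <ᵇ dist p i j))) (∑<-below (<⇒≤ (dist< i j)))

∑-load : ∀ p (A : Digraph p) → ∑[ e < p ] load p A e ≡ ∑[ i < p ] ∑[ j < p ] (ind (A i j) * dist p i j)
∑-load p A = begin
  ∑[ e < p ] load p A e
    ≡⟨ sum-cong-≗ (λ e → ΣΣ≡∑∑ p (λ i j → ind (A i j ∧ onRoute p e i j))) ⟩
  ∑[ e < p ] ∑[ i < p ] ∑[ j < p ] ind (A i j ∧ onRoute p e i j)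
    ≡⟨ ∑-comm (λ e i → ∑[ j < p ] ind (A i j ∧ onRoute p e i j)) ⟩
  ∑[ i < p ] ∑[ e < p ] ∑[ j < p ] ind (A i j ∧ onRoute p e i j)
    ≡⟨ sum-cong-≗ (λ i → ∑-comm (λ e j → ind (A i j ∧ onRoute p e i j))) ⟩
  ∑[ i < p ] ∑[ j < p ] ∑[ e < p ] ind (A i j ∧ onRoute p e i j)
    ≡⟨ sum-cong-≗ (λ i → sum-cong-≗ (route i)) ⟩
  ∑[ i < p ] ∑[ j < p ] (ind (A i j) * dist p i j) ∎
  where
  open ≡-Reasoning
  route : ∀ i j → ∑[ e < p ] ind (A i j ∧ onRoute p e i j) ≡ ind (A i j) * dist p i j
  route i j = begin
    ∑[ e < p ] ind (A i j ∧ onRoute p e i j)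
      ≡⟨ sum-cong-≗ (λ e → ind-∧ (A i j) (onRoute p e i j)) ⟩
    ∑[ e < p ] (ind (A i j) * ind (onRoute p e i j))
      ≡⟨ *-distribˡ-sum (ind (A i j)) (λ e → ind (onRoute p e i j)) ⟨
    ind (A i j) * ∑[ e < p ] ind (onRoute p e i j)
      ≡⟨ cong (ind (A i j) *_) (∑-onRoute i j) ⟩
    ind (A i j) * dist p i j ∎

excess : ℕ → ℕ → ℕ
excess k zero    = 0
excess k (suc d) = k ∸ d

∑<-excess : ∀ n k → ∑< n (excess k) ≤ triangular k
∑<-excess zero    k = z≤n
∑<-excess (suc n) k = ∑<-∸-≤-triangular n k

ind*[1+k]≤ind*d+excess : ∀ k x d → (d ≡ 0 → x ≡ false) → ind x * suc k ≤ ind x * d + excess k d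
ind*[1+k]≤ind*d+excess k false d       _         = z≤n
ind*[1+k]≤ind*d+excess k true  zero    d≡0⇒false = contradiction (d≡0⇒false refl) λ ()
ind*[1+k]≤ind*d+excess k true  (suc d) _         = begin
  suc k + 0           ≡⟨ +-identityʳ (suc k) ⟩
  suc k               ≤⟨ m≤n+m∸n (suc k) (suc d) ⟩
  suc d + (k ∸ d)     ≡⟨ cong (_+ (k ∸ d)) (+-identityʳ (suc d)) ⟨
  suc d + 0 + (k ∸ d) ∎
  where open ≤-Reasoning

arcs*[1+k]≤ : ∀ k {C p} (A : Digraph p) → Admissible C p A →
              arcs p A * suc k ≤ p * C + p * triangular k
arcs*[1+k]≤ k {C} {p} A ((irreflexive , _) , load≤C) = begin
  arcs p A * suc k
    ≡⟨ cong (_* suc k) (ΣΣ≡∑∑ p (λ i j → ind (A i j))) ⟩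
  (∑[ i < p ] ∑[ j < p ] ind (A i j)) * suc k
    ≡⟨ *-distribʳ-sum (suc k) (λ i → ∑[ j < p ] ind (A i j)) ⟩
  ∑[ i < p ] ((∑[ j < p ] ind (A i j)) * suc k)
    ≡⟨ sum-cong-≗ (λ i → *-distribʳ-sum (suc k) (λ j → ind (A i j))) ⟩
  ∑[ i < p ] ∑[ j < p ] (ind (A i j) * suc k)
    ≤⟨ ∑-mono-≤ (λ i → ∑-mono-≤ (λ j →
         ind*[1+k]≤ind*d+excess k (A i j) (dist p i j) (no-loop i j))) ⟩
  ∑[ i < p ] ∑[ j < p ] (ind (A i j) * dist p i j + excess k (dist p i j))
    ≡⟨ sum-cong-≗ (λ i → ∑-distrib-+ (λ j → ind (A i j) * dist p i j) (λ j → excess k (dist p i j))) ⟩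
  ∑[ i < p ] (∑[ j < p ] (ind (A i j) * dist p i j) + ∑[ j < p ] excess k (dist p i j))
    ≡⟨ ∑-distrib-+ (λ i → ∑[ j < p ] (ind (A i j) * dist p i j))
                   (λ i → ∑[ j < p ] excess k (dist p i j)) ⟩
  (∑[ i < p ] ∑[ j < p ] (ind (A i j) * dist p i j)) + ∑[ i < p ] ∑[ j < p ] excess k (dist p i j)
    ≤⟨ +-mono-≤ total-length≤ total-excess≤ ⟩
  p * C + p * triangular k ∎
  where
  open ≤-Reasoning
  no-loop : ∀ i j → dist p i j ≡ 0 → A i j ≡ false
  no-loop i j d≡0 = subst (λ j → A i j ≡ false) (dist≡0⇒≡ i j d≡0) (irreflexive i)
  total-length≤ : ∑[ i < p ] ∑[ j < p ] (ind (A i j) * dist p i j) ≤ p * C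
  total-length≤ = begin
    ∑[ i < p ] ∑[ j < p ] (ind (A i j) * dist p i j) ≡⟨ ∑-load p A ⟨
    ∑[ e < p ] load p A e                          ≤⟨ ∑-mono-≤ load≤C ⟩
    ∑[ e < p ] C                                   ≡⟨ ∑-const p C ⟩
    p * C                                          ∎
  total-excess≤ : ∑[ i < p ] ∑[ j < p ] excess k (dist p i j) ≤ p * triangular k
  total-excess≤ = begin
    ∑[ i < p ] ∑[ j < p ] excess k (dist p i j)
      ≤⟨ ∑-mono-≤ row≤ ⟩
    ∑[ i < p ] triangular k
      ≡⟨ ∑-const p (triangular k) ⟩
    p * triangular k ∎
    where
    row≤ : ∀ i → ∑[ j < p ] excess k (dist p i j) ≤ triangular k
    row≤ i = ≤-trans (≤-reflexive (∑-dist-from i (excess k))) (∑<-excess p k)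

-- The extremal construction

module Construction (k r : ℕ) (r≤1+k : r ≤ suc k) where

  K : ℕ
  K = suc k

  p : ℕ
  p = 3 * K

  K<p : K < p
  K<p = m<m+n K z<s

  longArc : ℕ → Bool
  longArc a = a % K <ᵇ r

  hasLength : ℕ → ℕ → Bool
  hasLength a m = ((0 <ᵇ m) ∧ (m <ᵇ K)) ∨ ((m ≡ᵇ K) ∧ longArc a)

  H : Digraph p
  H i j = hasLength (toℕ i) (dist p i j)

  ∑-hasLength-longer : ∀ a d →
    ∑< p (λ m → ind (hasLength a m ∧ (d <ᵇ m))) ≡ k ∸ d + ind ((d <ᵇ K) ∧ longArc a)
  ∑-hasLength-longer a d = begin
    ∑< p (λ m → ind (hasLength a m ∧ (d <ᵇ m)))
      ≡⟨ ∑<-cong p (λ m _ → split m) ⟩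
    ∑< p (λ m → ind (m <ᵇ K) * ind (d <ᵇ m) + ind (m ≡ᵇ K) * ind ((d <ᵇ m) ∧ longArc a))
      ≡⟨ ∑-distrib-+ {p} (λ m → ind (toℕ m <ᵇ K) * ind (d <ᵇ toℕ m))
                     (λ m → ind (toℕ m ≡ᵇ K) * ind ((d <ᵇ toℕ m) ∧ longArc a)) ⟩
    ∑< p (λ m → ind (m <ᵇ K) * ind (d <ᵇ m))
      + ∑< p (λ m → ind (m ≡ᵇ K) * ind ((d <ᵇ m) ∧ longArc a))
      ≡⟨ cong₂ _+_ (trans (∑<-restrict (λ m → ind (d <ᵇ m)) (<⇒≤ K<p)) (∑<-above K d))
                   (∑<-sift (λ m → ind ((d <ᵇ m) ∧ longArc a)) K<p) ⟩
    k ∸ d + ind ((d <ᵇ K) ∧ longArc a) ∎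
    where
    open ≡-Reasoning
    split : ∀ m → ind (hasLength a m ∧ (d <ᵇ m))
                ≡ ind (m <ᵇ K) * ind (d <ᵇ m) + ind (m ≡ᵇ K) * ind ((d <ᵇ m) ∧ longArc a)
    split zero    = refl
    split (suc m) = ind-∨∧ (suc m <ᵇ K) (suc m ≡ᵇ K) (longArc a) (d <ᵇ suc m) (<ᵇ∧≡ᵇ (suc m) K)

  ∑-hasLength : ∀ a → ∑< p (λ m → ind (hasLength a m)) ≡ k + ind (longArc a)
  ∑-hasLength a = trans (∑<-cong p (λ m _ → positive m)) (∑-hasLength-longer a 0)
    where
    positive : ∀ m → ind (hasLength a m) ≡ ind (hasLength a m ∧ (0 <ᵇ m))
    positive zero    = refl
    positive (suc m) = cong ind (sym (∧-identityʳ (hasLength a (suc m))))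

  ∑-longArc : ∑< p (λ a → ind (longArc a)) ≡ 3 * r
  ∑-longArc = trans (∑<-periodic 3 K (λ x → ind (x <ᵇ r))) (cong (3 *_) (∑<-below r≤1+k))

  arcs-H : arcs p H ≡ p * k + 3 * r
  arcs-H = begin
    arcs p H
      ≡⟨ ΣΣ≡∑∑ p (λ i j → ind (H i j)) ⟩
    ∑[ i < p ] ∑[ j < p ] ind (H i j)
      ≡⟨ sum-cong-≗ {p} (λ i → trans (∑-dist-from i (λ m → ind (hasLength (toℕ i) m)))
                                     (∑-hasLength (toℕ i))) ⟩
    ∑[ i < p ] (k + ind (longArc (toℕ i)))
      ≡⟨ ∑-distrib-+ {p} (λ _ → k) (λ i → ind (longArc (toℕ i))) ⟩
    ∑[ i < p ] k + ∑< p (λ a → ind (longArc a))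
      ≡⟨ cong₂ _+_ (∑-const p k) ∑-longArc ⟩
    p * k + 3 * r ∎
    where open ≡-Reasoning

  arcs-H*K : arcs p H * K ≡ (k * K + r) * p
  arcs-H*K = trans (cong (_* K) arcs-H) (identity k r)
    where
    identity : ∀ k r → (3 * suc k * k + 3 * r) * suc k ≡ (k * suc k + r) * (3 * suc k)
    identity = solve-∀

  H-irreflexive : ∀ i → H i i ≡ false
  H-irreflexive i = cong (hasLength (toℕ i)) (distℕ-self p (toℕ i))

  hasLength⇒≤K : ∀ a m → hasLength a m ≡ true → m ≤ K
  hasLength⇒≤K a zero    ()
  hasLength⇒≤K a (suc m) has with suc m <ᵇ K in m<K
  ... | true = <⇒≤ (<ᵇ⇒< (suc m) K (subst T (sym m<K) _))
  ... | false with suc m ≡ᵇ K in m≡K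
  ...   | true = ≤-reflexive (≡ᵇ⇒≡ (suc m) K (subst T (sym m≡K) _))
  hasLength⇒≤K a (suc m) () | false | false

  H-antisymmetric : ∀ i j → ¬ (H i j ≡ true × H j i ≡ true)
  H-antisymmetric i j (Hij , Hji) = <⇒≱ 2K<p (begin
    p                         ≡⟨ distℕ+distℕ (toℕ<n i) (toℕ<n j) i≢j ⟨
    dist p i j + dist p j i   ≤⟨ +-mono-≤ (hasLength⇒≤K (toℕ i) (dist p i j) Hij)
                                           (hasLength⇒≤K (toℕ j) (dist p j i) Hji) ⟩
    K + K                     ∎)
    where
    open ≤-Reasoning
    2K<p : K + K < p
    2K<p = +-monoʳ-< K (m<m+n K z<s)
    i≢j : toℕ i ≢ toℕ j
    i≢j toℕi≡toℕj with refl ← toℕ-injective toℕi≡toℕj =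
      contradiction (trans (sym Hij) (H-irreflexive i)) λ ()

  ∑-window : ∀ {e} → e < p → ∑< p (λ d → ind ((d <ᵇ K) ∧ longArc (distℕ p d e))) ≡ r
  ∑-window {e} e<p = begin
    ∑< p (λ d → ind ((d <ᵇ K) ∧ longArc (distℕ p d e)))
      ≡⟨ ∑<-cong p (λ d _ → ind-∧ (d <ᵇ K) (longArc (distℕ p d e))) ⟩
    ∑< p (λ d → ind (d <ᵇ K) * ind (longArc (distℕ p d e)))
      ≡⟨ ∑<-restrict (λ d → ind (longArc (distℕ p d e))) (<⇒≤ K<p) ⟩
    ∑< K (λ d → ind (longArc (distℕ p d e)))
      ≡⟨ ∑<-cong K (λ d d<K → cong (λ x → ind (x <ᵇ r)) (residue d<K)) ⟩
    ∑< K (λ d → ind ((p + e ∸ d) % K <ᵇ r))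
      ≡⟨ ∑<-reverse K (λ d → ind ((p + e ∸ d) % K <ᵇ r)) ⟨
    ∑< K (λ m → ind ((p + e ∸ (k ∸ m)) % K <ᵇ r))
      ≡⟨ ∑<-cong K (λ m m<K → cong (λ x → ind (x % K <ᵇ r))
                                   (m∸[n∸o]≡m∸n+o (<⇒≤pred m<K) k≤p+e)) ⟩
    ∑< K (λ m → ind ((p + e ∸ k + m) % K <ᵇ r))
      ≡⟨ ∑<-rotate K (p + e ∸ k) (λ x → ind (x <ᵇ r)) ⟩
    ∑< K (λ x → ind (x <ᵇ r))
      ≡⟨ ∑<-below r≤1+k ⟩
    r ∎
    where
    open ≡-Reasoning
    residue : ∀ {d} → d < K → distℕ p d e % K ≡ (p + e ∸ d) % K
    residue {d} d<K = trans (cong (_% K) (distℕ≡% (<-trans d<K K<p) e<p))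
                            (m∣n⇒o%n%m≡o%m K p (p + e ∸ d) (n∣m*n 3))
    k≤p+e : k ≤ p + e
    k≤p+e = ≤-trans (n≤1+n k) (≤-trans (<⇒≤ K<p) (m≤m+n p e))

  load-H : ∀ e → load p H e ≤ triangular k + r
  load-H e = begin
    load p H e
      ≡⟨ ΣΣ≡∑∑ p (λ i j → ind (H i j ∧ onRoute p e i j)) ⟩
    ∑[ i < p ] ∑[ j < p ] ind (H i j ∧ onRoute p e i j)
      ≡⟨ sum-cong-≗ {p} (λ i → trans (∑-dist-from i (λ m → ind (hasLength (toℕ i) m ∧ (dist p i e <ᵇ m))))
                                 (∑-hasLength-longer (toℕ i) (dist p i e))) ⟩
    ∑[ i < p ] (k ∸ dist p i e + ind ((dist p i e <ᵇ K) ∧ longArc (toℕ i)))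
      ≡⟨ ∑-dist-to e (λ a d → k ∸ d + ind ((d <ᵇ K) ∧ longArc a)) ⟩
    ∑< p (λ d → k ∸ d + ind ((d <ᵇ K) ∧ longArc (distℕ p d (toℕ e))))
      ≡⟨ ∑-distrib-+ {p} (λ d → k ∸ toℕ d)
                         (λ d → ind ((toℕ d <ᵇ K) ∧ longArc (distℕ p (toℕ d) (toℕ e)))) ⟩
    ∑< p (k ∸_) + ∑< p (λ d → ind ((d <ᵇ K) ∧ longArc (distℕ p d (toℕ e))))
      ≡⟨ cong (∑< p (k ∸_) +_) (∑-window (toℕ<n e)) ⟩
    ∑< p (k ∸_) + r
      ≤⟨ +-monoˡ-≤ r (∑<-∸-≤-triangular p k) ⟩
    triangular k + r ∎
    where open ≤-Reasoning

proposition3 : (C k r : ℕ) → 1 ≤ C → 1 ≤ k → r ≤ k → C ≡ (k * suc k) / 2 + r →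
    ((p : ℕ) → 2 ≤ p → (A : Digraph p) → Admissible C p A →
      arcs p A * suc k ≤ (k * suc k + r) * p)
    × (∃[ p ] (2 ≤ p × Σ[ A ∈ Digraph p ] (Admissible C p A ×
      arcs p A * suc k ≡ (k * suc k + r) * p)))
proposition3 C k r _ _ r≤k C≡ = upper , lower
  where
  open Construction k r (m≤n⇒m≤1+n r≤k)

  C≡T+r : C ≡ triangular k + r
  C≡T+r = trans C≡ (cong (_+ r) (k*[1+k]/2≡triangular k))

  C+T≡ : C + triangular k ≡ k * suc k + r
  C+T≡ = begin
    C + triangular k                    ≡⟨ cong (_+ triangular k) C≡T+r ⟩
    triangular k + r + triangular k     ≡⟨ x+r+x≡x*2+r (triangular k) r ⟩
    triangular k * 2 + r                ≡⟨ cong (_+ r) (triangular*2 k) ⟩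
    k * suc k + r                       ∎
    where
    open ≡-Reasoning
    x+r+x≡x*2+r : ∀ x r → x + r + x ≡ x * 2 + r
    x+r+x≡x*2+r = solve-∀

  upper : (q : ℕ) → 2 ≤ q → (A : Digraph q) → Admissible C q A → arcs q A * suc k ≤ (k * suc k + r) * q
  upper q _ A admissible = begin
    arcs q A * suc k           ≤⟨ arcs*[1+k]≤ k A admissible ⟩
    q * C + q * triangular k   ≡⟨ *-distribˡ-+ q C (triangular k) ⟨
    q * (C + triangular k)     ≡⟨ cong (q *_) C+T≡ ⟩
    q * (k * suc k + r)        ≡⟨ *-comm q _ ⟩
    (k * suc k + r) * q        ∎
    where open ≤-Reasoning

  lower : ∃[ q ] (2 ≤ q × Σ[ A ∈ Digraph q ] (Admissible C q A × arcs q A * suc k ≡ (k * suc k + r) * q))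
  lower = p , ≤-trans (s≤s (s≤s z≤n)) (m≤m*n 3 K) , H
            , ((H-irreflexive , H-antisymmetric) , (λ e → subst (load p H e ≤_) (sym C≡T+r) (load-H e)))
            , arcs-H*K
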